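{- Let $G$ be a $6$-minimal graph with maximum degree at most $3$ and girth at least $7$. Then $G$ does not contain an $H$-configuration, that is, a vertex of class $1$ adjacent to two vertices of class $2$.
   Context: All graphs are finite and simple. The square $G^2$ of $G$ has vertex set $V(G)$, with two vertices adjacent if their distance in $G$ is at most $2$. A graph is $k$-choosable if it admits a proper coloring from any assignment of lists of size $k$. A graph $G$ is $k$-minimal if $G^2$ is not $k$-choosable but $H^2$ is $k$-choosable for every proper subgraph $H$ of $G$. A vertex of degree $3$ is of class $i$ if it is adjacent to exactly $i$ vertices of degree $2$. -}

module Defs where

open import Data.Nat using (ℕ; zero; suc; _≤_)
open import Data.Bool using (Bool; true; false; if_then_else_)
open import Data.Fin using (Fin)
open import Data.List using (List; []; _∷_; [_]; _++_; length; map; allFin)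
open import Data.Nat.ListAction using (sum)
open import Data.List.Membership.Propositional using (_∈_)
open import Data.List.Relation.Unary.Unique.Propositional using (Unique)
open import Data.Product using (Σ; _×_; ∃; ∃-syntax)
open import Data.Sum using (_⊎_)
open import Data.Unit using (⊤)
open import Data.Empty using (⊥)
open import Relation.Binary.PropositionalEquality using (_≡_; _≢_)
open import Relation.Nullary using (¬_)

record Graph : Set where
  field
    n      : ℕ
    adj    : Fin n → Fin n → Bool
    sym    : ∀ u v → adj u v ≡ adj v u
    irrefl : ∀ v → adj v v ≡ false

-- Generic notions for a "graph" given by a vertex predicate Vx and an edge
-- relation Ed on an ambient set Fin n (used both for G and its subgraphs).

SqAdj : {n : ℕ} → (Fin n → Fin n → Set) → Fin n → Fin n → Set
SqAdj {n} Ed u v = u ≢ v × (Ed u v ⊎ Σ (Fin n) (λ w → Ed u w × Ed w v))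

IsKList : {n : ℕ} → ℕ → (Fin n → List ℕ) → Set
IsKList k L = ∀ v → length (L v) ≡ k × Unique (L v)

SquareChoosable : {n : ℕ} → (Fin n → Set) → (Fin n → Fin n → Set) → ℕ → Set
SquareChoosable {n} Vx Ed k =
  ∀ (L : Fin n → List ℕ) → IsKList k L →
  Σ (Fin n → ℕ) λ c →
    (∀ v → Vx v → c v ∈ L v) ×
    (∀ u v → Vx u → Vx v → SqAdj Ed u v → c u ≢ c v)

module _ (G : Graph) where
  open Graph G

  Edge : Fin n → Fin n → Set
  Edge u v = adj u v ≡ true

  AllV : Fin n → Set
  AllV _ = ⊤

  record Subgraph : Set where
    field
      keepV   : Fin n → Bool
      keepE   : Fin n → Fin n → Bool
      keepE-sym  : ∀ u v → keepE u v ≡ keepE v u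
      keepE-adj  : ∀ u v → keepE u v ≡ true → adj u v ≡ true
      keepE-endp : ∀ u v → keepE u v ≡ true → keepV u ≡ true

  Proper : Subgraph → Set
  Proper H = (∃[ v ] keepV v ≡ false) ⊎ (∃[ u ] ∃[ v ] (adj u v ≡ true × keepE u v ≡ false))
    where open Subgraph H

  SubV : Subgraph → Fin n → Set
  SubV H v = Subgraph.keepV H v ≡ true

  SubE : Subgraph → Fin n → Fin n → Set
  SubE H u v = Subgraph.keepE H u v ≡ true

  Minimal : ℕ → Set
  Minimal k = ¬ SquareChoosable AllV Edge k ×
              (∀ (H : Subgraph) → Proper H → SquareChoosable (SubV H) (SubE H) k)

  deg : Fin n → ℕ
  deg u = sum (map (λ v → if adj u v then 1 else 0) (allFin n))

  MaxDegAtMost : ℕ → Set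
  MaxDegAtMost d = ∀ u → deg u ≤ d

  Walk : List (Fin n) → Set
  Walk []            = ⊤
  Walk (x ∷ [])      = ⊤
  Walk (x ∷ y ∷ r)   = Edge x y × Walk (y ∷ r)

  IsCycle : List (Fin n) → Set
  IsCycle []       = ⊥
  IsCycle (x ∷ xs) = 3 ≤ length (x ∷ xs) × Unique (x ∷ xs) × Walk (x ∷ xs ++ [ x ])

  -- girth at least g (acyclic graphs have infinite girth)
  GirthAtLeast : ℕ → Set
  GirthAtLeast g = ∀ cyc → IsCycle cyc → g ≤ length cyc

  deg2Nbrs : Fin n → ℕ
  deg2Nbrs u = sum (map (λ v → if adj u v then (if isTwo (deg v) then 1 else 0) else 0) (allFin n))
    where
      isTwo : ℕ → Bool
      isTwo 2 = true
      isTwo _ = false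

  OfClass : ℕ → Fin n → Set
  OfClass i u = deg u ≡ 3 × deg2Nbrs u ≡ i

  HConfiguration : Set
  HConfiguration = ∃[ u ] ∃[ v ] ∃[ w ]
    (OfClass 1 u × Edge u v × Edge u w × v ≢ w × OfClass 2 v × OfClass 2 w)

-- Delete the eight vertices u; v, w, x; v₁, v₂, w₁, w₂ of the H-configuration (u of class 1 with
-- degree-2 neighbour x, v and w of class 2 with degree-2 neighbours v₁, v₂ and w₁, w₂). By
-- minimality the square of the remaining graph is 6-choosable; we extend such a colouring.
-- Girth at least 7 keeps the configuration and the far neighbours x′, v₁′, … of its degree-2
-- vertices tree-like: every deleted vertex has at most one neighbour outside, the rest of the
-- graph forbids at most 1 colour at u, 2 at v and w and 3 at each degree-2 vertex, and two deleted
-- vertices are within distance 2 only if they are so in the tree. Colour greedily in the order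
-- u, v, x, w, v₂, w₂, v₁, w₁, reserving 3-colour palettes for v₁ and w₁: u avoids the palette of
-- w₁, and v avoids the palette of v₁ whenever u's colour lies in it. Then G² is 6-choosable,
-- contradicting minimality.

module Submission where

open import Data.Bool using (Bool; true; false; not; _∧_; if_then_else_; T)
open import Data.Bool.Properties using (∧-comm) renaming (_≟_ to _≟ᵇ_)
open import Data.Empty using (⊥; ⊥-elim)
open import Data.Fin using (Fin)
open import Data.Fin.Properties using () renaming (_≟_ to _≟ᶠ_)
open import Data.List
  using (List; []; _∷_; [_]; _++_; length; map; filter; filterᵇ; allFin; concatMap; fromMaybe)
open import Data.List.Membership.Propositional using (_∈_; _∉_; lose)
open import Data.List.Membership.Propositional.Properties
  using (∈-filter⁺; ∈-filter⁻; ∈-allFin; ∈-++⁺ˡ; ∈-++⁺ʳ; ∈-map⁺; ∈-map⁻; ∈-concat⁺′)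
open import Data.List.Properties using (filter-notAll; length-++; length-map; ++-identityʳ)
open import Data.List.Relation.Binary.Subset.Propositional using (_⊆_)
open import Data.List.Relation.Unary.All as All using (All; []; _∷_)
open import Data.List.Relation.Unary.Any as Any using (here; there; any?)
open import Data.List.Relation.Unary.AllPairs using ([]; _∷_)
open import Data.List.Relation.Unary.All.Properties using (¬Any⇒All¬)
open import Data.List.Relation.Unary.Unique.Propositional using (Unique)
open import Data.List.Relation.Unary.Unique.Propositional.Properties using (filter⁺; allFin⁺)
open import Data.Maybe using (Maybe; just; nothing)
open import Data.Maybe.Properties using (just-injective)
open import Data.Nat using (ℕ; zero; suc; _+_; _≤_; _<_; _<ᵇ_; z≤n; s≤s)
import Data.Nat as ℕ
open import Data.Nat.ListAction using (sum)
open import Data.Nat.Properties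
open import Data.Product using (Σ; ∃; ∃₂; ∃-syntax; _×_; _,_; -,_; proj₁; proj₂)
open import Data.Sum using (_⊎_; inj₁; inj₂)
open import Data.Unit using (tt)
open import Function using (_∘_)
open import Relation.Binary.Definitions using (DecidableEquality; tri<; tri≈; tri>)
open import Relation.Binary.PropositionalEquality
  using (_≡_; _≢_; refl; sym; trans; cong; cong₂; subst; ≢-sym)
open import Relation.Nullary using (¬_; Dec; yes; no; ¬?)
import Relation.Nullary.Decidable as Dec
open import Relation.Unary using (Decidable)
open import Defs

module _ {A : Set} (_≟_ : DecidableEquality A) where
  open import Data.List.Membership.DecPropositional _≟_ using (_∈?_)

  longer⇒∃∉ : ∀ {xs : List A} ys → Unique xs → length ys < length xs → ∃[ x ] x ∈ xs × x ∉ ys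
  longer⇒∃∉ {x ∷ xs} ys (x∉xs ∷ xs!) (s≤s ys≤xs) with x ∈? ys
  ... | no x∉ys = x , here refl , x∉ys
  ... | yes x∈ys =
    let z , z∈xs , z∉ys′ = longer⇒∃∉ ys′ xs! (<-≤-trans shorter ys≤xs)
    in z , there z∈xs , λ z∈ys → z∉ys′ (∈-filter⁺ x≢? z∈ys (All.lookup x∉xs z∈xs))
    where
      x≢? : Decidable (x ≢_)
      x≢? y = ¬? (x ≟ y)
      ys′ : List A
      ys′ = filter x≢? ys
      shorter : length ys′ < length ys
      shorter = filter-notAll x≢? ys (Any.map (λ x≡y x≢y → x≢y x≡y) x∈ys)

  unique-⊆⇒length≤ : ∀ {xs ys : List A} → Unique xs → xs ⊆ ys → length xs ≤ length ys
  unique-⊆⇒length≤ {ys = ys} xs! xs⊆ys =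
    ≮⇒≥ λ ys<xs → let _ , z∈xs , z∉ys = longer⇒∃∉ ys xs! ys<xs in z∉ys (xs⊆ys z∈xs)

  ∃-unique-outside : ∀ k {L : List A} (K : List A) → Unique L → k + length K ≤ length L →
                     ∃[ P ] length P ≡ k × Unique P × P ⊆ L × (∀ {a} → a ∈ P → a ∉ K)
  ∃-unique-outside zero K L! _ = [] , refl , [] , (λ ()) , λ ()
  ∃-unique-outside (suc k) {L} K L! room =
    let d , d∈L , d∉K = longer⇒∃∉ K L! (≤-trans (s≤s (m≤n+m _ k)) room)
        P , |P| , P! , P⊆L , P∩dK =
          ∃-unique-outside k (d ∷ K) L! (subst (_≤ length L) (sym (+-suc k _)) room)
    in d ∷ P , cong suc |P|
     , All.tabulate (λ p∈P d≡p → P∩dK p∈P (here (sym d≡p))) ∷ P!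
     , (λ { (here refl) → d∈L ; (there p∈P) → P⊆L p∈P })
     , λ { (here refl) → d∉K ; (there p∈P) → P∩dK p∈P ∘ there }

module _ {A : Set} where

  sum-positive : ∀ (f : A → ℕ) xs → 1 ≤ sum (map f xs) → ∃[ a ] a ∈ xs × 1 ≤ f a
  sum-positive f (x ∷ xs) pos with f x in fx
  ... | suc _ = x , here refl , subst (1 ≤_) (sym fx) (s≤s z≤n)
  ... | zero  = let a , a∈xs , fa = sum-positive f xs pos in a , there a∈xs , fa

  sum≥2 : ∀ (f : A → ℕ) {xs} → Unique xs → (∀ a → f a ≤ 1) → 2 ≤ sum (map f xs) →
          ∃₂ λ a b → a ≢ b × 1 ≤ f a × 1 ≤ f b
  sum≥2 f {x ∷ xs} (x∉xs ∷ xs!) f≤1 two with f x in fx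
  ... | zero = sum≥2 f xs! f≤1 two
  ... | suc zero = let b , b∈xs , fb = sum-positive f xs (≤-pred two)
                   in x , b , All.lookup x∉xs b∈xs , subst (1 ≤_) (sym fx) ≤-refl , fb
  ... | suc (suc _) = ⊥-elim (1+n≰n (≤-trans (m≤m+n 2 _) (subst (_≤ 1) fx (f≤1 x))))

  sum-indicator : ∀ (p : A → Bool) xs → sum (map (λ a → if p a then 1 else 0) xs) ≡ length (filterᵇ p xs)
  sum-indicator p [] = refl
  sum-indicator p (x ∷ xs) with p x
  ... | true  = cong suc (sum-indicator p xs)
  ... | false = sum-indicator p xs

-- The summands of deg2Nbrs.
indicator-positive : ∀ b c → 1 ≤ (if b then (if c then 1 else 0) else 0) → b ≡ true × c ≡ true
indicator-positive true true _ = refl , refl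

indicator≤1 : ∀ b c → (if b then (if c then 1 else 0) else 0) ≤ 1
indicator≤1 true true = ≤-refl
indicator≤1 true false = z≤n
indicator≤1 false _ = z≤n

module _ (G : Graph) where
  open Graph G using (n; adj) renaming (sym to adj-sym; irrefl to adj-irrefl)

  open import Data.List.Membership.DecPropositional (_≟ᶠ_ {n}) using (_∈?_)

  private
    E : Fin n → Fin n → Set
    E = Edge G

  neighbours : Fin n → List (Fin n)
  neighbours y = filterᵇ (adj y) (allFin n)

  deg≡length : ∀ y → deg G y ≡ length (neighbours y)
  deg≡length y = sum-indicator (adj y) (allFin n)

  ∈-neighbours : ∀ {y m} → E y m → m ∈ neighbours y
  ∈-neighbours {y} {m} ym = ∈-filter⁺ _ (∈-allFin m) (subst T (sym ym) tt)

  edge-sym : ∀ {a b} → E a b → E b a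
  edge-sym {a} {b} ab = trans (adj-sym b a) ab

  edge-≢ : ∀ {a b} → E a b → a ≢ b
  edge-≢ {a} aa refl with () ← trans (sym aa) (adj-irrefl a)

  sqAdj-sym : ∀ {a b} → SqAdj E a b → SqAdj E b a
  sqAdj-sym (a≢b , inj₁ ab) = ≢-sym a≢b , inj₁ (edge-sym ab)
  sqAdj-sym (a≢b , inj₂ (m , am , mb)) = ≢-sym a≢b , inj₂ (m , edge-sym mb , edge-sym am)

  deg3≢deg2 : ∀ {a b} → deg G a ≡ 3 → deg G b ≡ 2 → a ≢ b
  deg3≢deg2 da db refl with () ← trans (sym da) db

  neighbours-unique : ∀ y → Unique (neighbours y)
  neighbours-unique y = filter⁺ _ (allFin⁺ n)

  ∈-neighbours⁻ : ∀ {y m} → m ∈ neighbours y → E y m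
  ∈-neighbours⁻ {y} {m} m∈ with adj y m | proj₂ (∈-filter⁻ _ {xs = allFin n} m∈)
  ... | true | _ = refl

  neighbours-complete : ∀ {y m As} → deg G y ≤ length As → Unique As → All (E y) As →
                        E y m → m ∈ As
  neighbours-complete {y} {m} {As} deg≤ As! edges ym with m ∈? As
  ... | yes m∈As = m∈As
  ... | no m∉As = ⊥-elim (1+n≰n (begin
    suc (length As)         ≤⟨ unique-⊆⇒length≤ _≟ᶠ_ (¬Any⇒All¬ As m∉As ∷ As!) ⊆neighbours ⟩
    length (neighbours y)   ≡⟨ deg≡length y ⟨
    deg G y                 ≤⟨ deg≤ ⟩
    length As               ∎))
    where
      open ≤-Reasoning
      ⊆neighbours : (m ∷ As) ⊆ neighbours y
      ⊆neighbours (here refl) = ∈-neighbours ym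
      ⊆neighbours (there p∈As) = ∈-neighbours (All.lookup edges p∈As)

  other-neighbour : ∀ {y} → 2 ≤ deg G y → ∀ a → ∃[ b ] E y b × b ≢ a
  other-neighbour {y} two a =
    let b , b∈ , b∉[a] =
          longer⇒∃∉ _≟ᶠ_ [ a ] (neighbours-unique y) (subst (2 ≤_) (deg≡length y) two)
    in b , ∈-neighbours⁻ b∈ , b∉[a] ∘ here

  -- deg2Nbrs compares degrees with 2 through a function local to Defs, hence the case splits on
  -- the degree.
  class1-neighbour : ∀ {u} → deg2Nbrs G u ≡ 1 → ∃[ a ] E u a × deg G a ≡ 2
  class1-neighbour {u} cls with sum-positive _ (allFin n) (≤-reflexive (sym cls))
  ... | a , _ , pos with indicator-positive (adj u a) _ pos
  ... | ua , two with deg G a in da | two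
  ... | 2 | _ = a , ua , da
  ... | 0 | ()
  ... | 1 | ()
  ... | suc (suc (suc _)) | ()

  class2-neighbours : ∀ {u} → deg2Nbrs G u ≡ 2 →
                      ∃₂ λ a b → a ≢ b × E u a × deg G a ≡ 2 × E u b × deg G b ≡ 2
  class2-neighbours {u} cls
    with sum≥2 _ (allFin⁺ n) (λ a → indicator≤1 (adj u a) _) (≤-reflexive (sym cls))
  ... | a , b , a≢b , pos-a , pos-b
    with indicator-positive (adj u a) _ pos-a | indicator-positive (adj u b) _ pos-b
  ... | ua , two-a | ub , two-b with deg G a in da | two-a
  ... | 0 | ()
  ... | 1 | ()
  ... | suc (suc (suc _)) | ()
  ... | 2 | _ with deg G b in db | two-b
  ...   | 0 | ()
  ...   | 1 | ()
  ...   | suc (suc (suc _)) | ()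
  ...   | 2 | _ = a , b , a≢b , ua , da , ub , db

  far-apart : ∀ {a b As Bs} → (∀ {m} → E a m → m ∈ As) → (∀ {m} → E b m → m ∈ Bs) →
              All (b ≢_) As → All (λ p → All (p ≢_) Bs) As → ¬ SqAdj E a b
  far-apart nbrs-a _ b∉As _ (_ , inj₁ ab) = All.lookup b∉As (nbrs-a ab) refl
  far-apart nbrs-a nbrs-b _ As∩Bs (_ , inj₂ (m , am , mb)) =
    All.lookup (All.lookup As∩Bs (nbrs-a am)) (nbrs-b (edge-sym mb)) refl

module _ {G : Graph} (girth : GirthAtLeast G 7) where
  open Graph G using (n)

  private
    E : Fin n → Fin n → Set
    E = Edge G

  short-cycle-impossible : ∀ cyc → IsCycle G cyc → length cyc ≤ 6 → ⊥
  short-cycle-impossible cyc cycle short = 1+n≰n (≤-trans (girth cyc cycle) short)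

  path₃-ends-≢ : ∀ {a b c d} → Unique (a ∷ b ∷ c ∷ []) → E a b → E b c → E c d → a ≢ d
  path₃-ends-≢ distinct ab bc ca refl =
    short-cycle-impossible _ (≤-refl , distinct , ab , bc , ca , tt) (m≤m+n 3 3)

  path₄-ends-≢ : ∀ {a b c d e} → Unique (a ∷ b ∷ c ∷ d ∷ []) →
                 E a b → E b c → E c d → E d e → a ≢ e
  path₄-ends-≢ distinct ab bc cd da refl =
    short-cycle-impossible _ (n≤1+n 3 , distinct , ab , bc , cd , da , tt) (m≤m+n 4 2)

  path₅-ends-≢ : ∀ {a b c d e f} → Unique (a ∷ b ∷ c ∷ d ∷ e ∷ []) →
                 E a b → E b c → E c d → E d e → E e f → a ≢ f
  path₅-ends-≢ distinct ab bc cd de ea refl =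
    short-cycle-impossible _ (m≤m+n 3 2 , distinct , ab , bc , cd , de , ea , tt) (n≤1+n 5)

  path₆-ends-≢ : ∀ {a b c d e f g} → Unique (a ∷ b ∷ c ∷ d ∷ e ∷ f ∷ []) →
                 E a b → E b c → E c d → E d e → E e f → E f g → a ≢ g
  path₆-ends-≢ distinct ab bc cd de ef fa refl =
    short-cycle-impossible _ (m≤m+n 3 3 , distinct , ab , bc , cd , de , ef , fa , tt) ≤-refl

data Label : Set where
  U V W X V₁ V₂ W₁ W₂ : Label

labels : List Label
labels = U ∷ V ∷ W ∷ X ∷ V₁ ∷ V₂ ∷ W₁ ∷ W₂ ∷ []

∈-labels : ∀ l → l ∈ labels
∈-labels U  = here refl
∈-labels V  = there (here refl)
∈-labels W  = there (there (here refl))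
∈-labels X  = there (there (there (here refl)))
∈-labels V₁ = there (there (there (there (here refl))))
∈-labels V₂ = there (there (there (there (there (here refl)))))
∈-labels W₁ = there (there (there (there (there (there (here refl))))))
∈-labels W₂ = there (there (there (there (there (there (there (here refl)))))))

image? : ∀ {n} (f : Label → Fin n) p → Dec (∃[ l ] p ≡ f l)
image? f p = Dec.map′ Any.satisfied (λ (l , p≡fl) → lose (∈-labels l) p≡fl)
                      (any? (λ l → p ≟ᶠ f l) labels)

tree-neighbours : Label → List Label
tree-neighbours U  = V ∷ W ∷ X ∷ []
tree-neighbours V  = U ∷ V₁ ∷ V₂ ∷ []
tree-neighbours W  = U ∷ W₁ ∷ W₂ ∷ []
tree-neighbours X  = U ∷ []
tree-neighbours V₁ = V ∷ []
tree-neighbours V₂ = V ∷ []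
tree-neighbours W₁ = W ∷ []
tree-neighbours W₂ = W ∷ []

-- The order in which the removed vertices are coloured.
rank : Label → ℕ
rank U  = 0
rank V  = 1
rank X  = 2
rank W  = 3
rank V₂ = 4
rank W₂ = 5
rank V₁ = 6
rank W₁ = 7

rank-injective : ∀ l l′ → rank l ≡ rank l′ → l ≡ l′
rank-injective U  U  _ = refl
rank-injective V  V  _ = refl
rank-injective W  W  _ = refl
rank-injective X  X  _ = refl
rank-injective V₁ V₁ _ = refl
rank-injective V₂ V₂ _ = refl
rank-injective W₁ W₁ _ = refl
rank-injective W₂ W₂ _ = refl

-- l ▷ l′ : l′ is coloured before l and lies within distance 2 of l in the tree.
data _▷_ : Label → Label → Set where
  v▷u : V ▷ U
  x▷u : X ▷ U
  x▷v : X ▷ V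
  w▷u : W ▷ U
  w▷v : W ▷ V
  w▷x : W ▷ X
  v₂▷u : V₂ ▷ U
  v₂▷v : V₂ ▷ V
  w₂▷u : W₂ ▷ U
  w₂▷w : W₂ ▷ W
  v₁▷u : V₁ ▷ U
  v₁▷v : V₁ ▷ V
  v₁▷v₂ : V₁ ▷ V₂
  w₁▷u : W₁ ▷ U
  w₁▷w : W₁ ▷ W
  w₁▷w₂ : W₁ ▷ W₂

-- Bound on the colours forbidden at each label by the rest of the graph: u sees only x′, v sees
-- v₁′ and v₂′, and a degree-2 vertex sees its outer neighbour and at most two neighbours of it.
budget : Label → ℕ
budget U = 1
budget V = 2
budget W = 2
budget _ = 3

module TreeColouring
  (L : Label → List ℕ) (L-unique : ∀ l → Unique (L l)) (L-size : ∀ l → length (L l) ≡ 6)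
  (K : Label → List ℕ) (K-small : ∀ l → length (K l) ≤ budget l)
  where
  open import Data.List.Membership.DecPropositional ℕ._≟_ using (_∈?_)

  record Choice (l : Label) (F : List ℕ) : Set where
    field
      colour : ℕ
      ∈L     : colour ∈ L l
      ∉K     : colour ∉ K l
      ∉F     : colour ∉ F

    avoids : ∀ {d} → d ∈ F → colour ≢ d
    avoids d∈F refl = ∉F d∈F

  choice-⊆ : ∀ {l F F′} → F′ ⊆ F → Choice l F → Choice l F′
  choice-⊆ F′⊆F ch = record { Choice ch ; ∉F = Choice.∉F ch ∘ F′⊆F }

  choose : ∀ l F → budget l + length F ≤ 5 → Choice l F
  choose l F room =
    let d , d∈L , d∉K++F = longer⇒∃∉ ℕ._≟_ (K l ++ F) (L-unique l) K++F<L
    in record { colour = d ; ∈L = d∈L ; ∉K = d∉K++F ∘ ∈-++⁺ˡ ; ∉F = d∉K++F ∘ ∈-++⁺ʳ (K l) }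
    where
      open ≤-Reasoning
      K++F<L : length (K l ++ F) < length (L l)
      K++F<L = begin-strict
        length (K l ++ F)        ≡⟨ length-++ (K l) ⟩
        length (K l) + length F  ≤⟨ +-monoˡ-≤ (length F) (K-small l) ⟩
        budget l + length F      ≤⟨ room ⟩
        5                        <⟨ n<1+n 5 ⟩
        6                        ≡⟨ L-size l ⟨
        length (L l)             ∎

  record Palette (l : Label) : Set where
    field
      colours  : List ℕ
      size     : length colours ≡ 3
      unique   : Unique colours
      ⊆L       : colours ⊆ L l
      disjoint : ∀ {d} → d ∈ colours → d ∉ K l

  palette : ∀ l → budget l ≡ 3 → Palette l
  palette l budget≡3 =
    let P , |P| , P! , P⊆L , P∩K = ∃-unique-outside ℕ._≟_ 3 (K l) (L-unique l) room
    in record { colours = P ; size = |P| ; unique = P! ; ⊆L = P⊆L ; disjoint = P∩K }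
    where
      room : 3 + length (K l) ≤ length (L l)
      room = ≤-trans (+-monoʳ-≤ 3 (subst (length (K l) ≤_) budget≡3 (K-small l)))
                     (≤-reflexive (sym (L-size l)))

  from-palette : ∀ {l} (P : Palette l) (D : List ℕ) {F} → length D ≤ 2 →
                 (∀ {d} → d ∈ Palette.colours P → d ∈ F → d ∈ D) → Choice l F
  from-palette P D short F∩P⊆D =
    let d , d∈P , d∉D = longer⇒∃∉ ℕ._≟_ D unique (≤-trans (s≤s short) (≤-reflexive (sym size)))
    in record { colour = d ; ∈L = ⊆L d∈P ; ∉K = disjoint d∈P ; ∉F = d∉D ∘ F∩P⊆D d∈P }
    where open Palette P

  v₁-palette : Palette V₁
  v₁-palette = palette V₁ refl

  w₁-palette : Palette W₁
  w₁-palette = palette W₁ refl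

  module A = Palette v₁-palette
  module B = Palette w₁-palette

  -- u avoids the palette of w₁, so that w₁ later only has to dodge w and w₂.
  u-choice : Choice U B.colours
  u-choice = choose U B.colours (≤-trans (≤-reflexive (cong suc B.size)) (n≤1+n 4))

  α : ℕ
  α = Choice.colour u-choice

  -- If α lies in the palette of v₁, then v avoids that whole palette; either way v₁ then
  -- loses at most two palette colours to u, v and v₂.
  choose-v : Dec (α ∈ A.colours) →
             Σ (Choice V [ α ]) λ ch → α ∈ A.colours → Choice.colour ch ∉ A.colours
  choose-v (yes α∈A) = choice-⊆ (λ { (here refl) → α∈A }) ch , λ _ → Choice.∉F ch
    where ch = choose V A.colours (≤-reflexive (cong (2 +_) A.size))
  choose-v (no α∉A) = choose V [ α ] (m≤m+n 3 2) , λ α∈A → ⊥-elim (α∉A α∈A)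

  α∈A? : Dec (α ∈ A.colours)
  α∈A? = α ∈? A.colours

  v-choice : Choice V [ α ]
  v-choice = proj₁ (choose-v α∈A?)

  c-v : ℕ
  c-v = Choice.colour v-choice

  x-choice : Choice X (α ∷ c-v ∷ [])
  x-choice = choose X _ ≤-refl

  w-choice : Choice W (α ∷ c-v ∷ Choice.colour x-choice ∷ [])
  w-choice = choose W _ ≤-refl

  v₂-choice : Choice V₂ (α ∷ c-v ∷ [])
  v₂-choice = choose V₂ _ ≤-refl

  w₂-choice : Choice W₂ (α ∷ Choice.colour w-choice ∷ [])
  w₂-choice = choose W₂ _ ≤-refl

  choose-v₁ : Dec (α ∈ A.colours) → (α ∈ A.colours → c-v ∉ A.colours) →
              Choice V₁ (α ∷ c-v ∷ Choice.colour v₂-choice ∷ [])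
  choose-v₁ (yes α∈A) c-v∉A = from-palette v₁-palette (α ∷ Choice.colour v₂-choice ∷ []) ≤-refl
    λ { _ (here refl) → here refl
      ; d∈A (there (here refl)) → ⊥-elim (c-v∉A α∈A d∈A)
      ; _ (there (there (here refl))) → there (here refl) }
  choose-v₁ (no α∉A) _ = from-palette v₁-palette (c-v ∷ Choice.colour v₂-choice ∷ []) ≤-refl
    λ { d∈A (here refl) → ⊥-elim (α∉A d∈A) ; _ (there d∈) → d∈ }

  v₁-choice : Choice V₁ (α ∷ c-v ∷ Choice.colour v₂-choice ∷ [])
  v₁-choice = choose-v₁ α∈A? (proj₂ (choose-v α∈A?))

  w₁-choice : Choice W₁ (α ∷ Choice.colour w-choice ∷ Choice.colour w₂-choice ∷ [])
  w₁-choice = from-palette w₁-palette _ ≤-refl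
    λ { d∈B (here refl) → ⊥-elim (Choice.∉F u-choice d∈B) ; _ (there d∈) → d∈ }

  choice : ∀ l → ∃ (Choice l)
  choice U  = -, u-choice
  choice V  = -, v-choice
  choice W  = -, w-choice
  choice X  = -, x-choice
  choice V₁ = -, v₁-choice
  choice V₂ = -, v₂-choice
  choice W₁ = -, w₁-choice
  choice W₂ = -, w₂-choice

  colouring : Label → ℕ
  colouring l = Choice.colour (proj₂ (choice l))

  colouring-∈L : ∀ l → colouring l ∈ L l
  colouring-∈L l = Choice.∈L (proj₂ (choice l))

  colouring-∉K : ∀ l → colouring l ∉ K l
  colouring-∉K l = Choice.∉K (proj₂ (choice l))

  colouring-▷ : ∀ {l l′} → l ▷ l′ → colouring l ≢ colouring l′
  colouring-▷ v▷u = Choice.avoids v-choice (here refl)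
  colouring-▷ x▷u = Choice.avoids x-choice (here refl)
  colouring-▷ x▷v = Choice.avoids x-choice (there (here refl))
  colouring-▷ w▷u = Choice.avoids w-choice (here refl)
  colouring-▷ w▷v = Choice.avoids w-choice (there (here refl))
  colouring-▷ w▷x = Choice.avoids w-choice (there (there (here refl)))
  colouring-▷ v₂▷u = Choice.avoids v₂-choice (here refl)
  colouring-▷ v₂▷v = Choice.avoids v₂-choice (there (here refl))
  colouring-▷ w₂▷u = Choice.avoids w₂-choice (here refl)
  colouring-▷ w₂▷w = Choice.avoids w₂-choice (there (here refl))
  colouring-▷ v₁▷u = Choice.avoids v₁-choice (here refl)
  colouring-▷ v₁▷v = Choice.avoids v₁-choice (there (here refl))
  colouring-▷ v₁▷v₂ = Choice.avoids v₁-choice (there (there (here refl)))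
  colouring-▷ w₁▷u = Choice.avoids w₁-choice (here refl)
  colouring-▷ w₁▷w = Choice.avoids w₁-choice (there (here refl))
  colouring-▷ w₁▷w₂ = Choice.avoids w₁-choice (there (there (here refl)))

-- Deleting S = vtx(Λ) from G, where every removed vertex has at most one neighbour outside S
-- (its exit) and its other neighbours are the images of its inner labels.
module Reduction
  (G : Graph) {Λ : Set} (vtx : Λ → Fin (Graph.n G))
  (removed? : ∀ p → Dec (∃[ l ] p ≡ vtx l))
  (exit : Λ → Maybe (Fin (Graph.n G))) (inner : Λ → List Λ)
  (cover : ∀ l {m} → Edge G (vtx l) m → exit l ≡ just m ⊎ m ∈ map vtx (inner l))
  where
  open Graph G using (n; adj) renaming (sym to adj-sym)

  private
    E : Fin n → Fin n → Set
    E = Edge G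

  keep : Fin n → Bool
  keep p = not (Dec.does (removed? p))

  Kept : Fin n → Set
  Kept p = keep p ≡ true

  Kept? : Decidable Kept
  Kept? p = keep p ≟ᵇ true

  removed-or-kept : ∀ p → (∃[ l ] p ≡ vtx l) ⊎ Kept p
  removed-or-kept p with removed? p
  ... | yes removed = inj₁ removed
  ... | no _ = inj₂ refl

  removed-not-kept : ∀ l → ¬ Kept (vtx l)
  removed-not-kept l with removed? (vtx l)
  ... | yes _ = λ ()
  ... | no not-removed = ⊥-elim (not-removed (l , refl))

  keep-edge : Fin n → Fin n → Bool
  keep-edge a b = adj a b ∧ (keep a ∧ keep b)

  ∧-true : ∀ a b → a ∧ b ≡ true → a ≡ true × b ≡ true
  ∧-true true true _ = refl , refl

  G-S : Subgraph G
  G-S = record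
    { keepV      = keep
    ; keepE      = keep-edge
    ; keepE-sym  = λ a b → cong₂ _∧_ (adj-sym a b) (∧-comm (keep a) (keep b))
    ; keepE-adj  = λ a b → proj₁ ∘ ∧-true (adj a b) _
    ; keepE-endp = λ a b → proj₁ ∘ ∧-true (keep a) _ ∘ proj₂ ∘ ∧-true (adj a b) _
    }

  G-S-proper : Λ → Proper G G-S
  G-S-proper l with keep (vtx l) in kept
  ... | false = inj₁ (vtx l , kept)
  ... | true  = ⊥-elim (removed-not-kept l kept)

  kept-edge : ∀ {p q} → Kept p → Kept q → E p q → SubE G G-S p q
  kept-edge kp kq pq rewrite pq | kp | kq = refl

  exit-reached : ∀ l {q} → Kept q → E (vtx l) q → exit l ≡ just q
  exit-reached l kq lq with cover l lq
  ... | inj₁ exit≡q = exit≡q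
  ... | inj₂ q∈inner with _ , _ , refl ← ∈-map⁻ vtx q∈inner = ⊥-elim (removed-not-kept _ kq)

  kept-sqAdj : ∀ {p q} → Kept p → Kept q → SqAdj E p q → SqAdj (SubE G G-S) p q
  kept-sqAdj kp kq (p≢q , inj₁ pq) = p≢q , inj₁ (kept-edge kp kq pq)
  kept-sqAdj {p} {q} kp kq (p≢q , inj₂ (m , pm , mq)) with removed-or-kept m
  ... | inj₂ km = p≢q , inj₂ (m , kept-edge kp km pm , kept-edge km kq mq)
  ... | inj₁ (l , refl) =
    ⊥-elim (p≢q (just-injective (trans (sym (exit-reached l kp (edge-sym G pm))) (exit-reached l kq mq))))

  kept-neighbours : Fin n → List (Fin n)
  kept-neighbours m = filter Kept? (neighbours G m)

  zone : Maybe (Fin n) → List (Fin n)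
  zone nothing  = []
  zone (just e) = e ∷ kept-neighbours e

  near-kept : Λ → List (Fin n)
  near-kept l = zone (exit l) ++ concatMap (fromMaybe ∘ exit) (inner l)

  near-kept-complete : ∀ l {q} → Kept q → SqAdj E (vtx l) q → q ∈ near-kept l
  near-kept-complete l kq (_ , inj₁ lq) rewrite exit-reached l kq lq = here refl
  near-kept-complete l {q} kq (_ , inj₂ (m , lm , mq)) with cover l lm
  ... | inj₁ exit≡m rewrite exit≡m = ∈-++⁺ˡ (there (∈-filter⁺ Kept? (∈-neighbours G mq) kq))
  ... | inj₂ m∈inner with t , t∈inner , refl ← ∈-map⁻ vtx m∈inner =
    ∈-++⁺ʳ (zone (exit l))
      (∈-concat⁺′ (subst (λ z → q ∈ fromMaybe z) (sym (exit-reached t kq mq)) (here refl))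
                  (∈-map⁺ (fromMaybe ∘ exit) t∈inner))

  forbidden : (Fin n → ℕ) → Λ → List ℕ
  forbidden c l = map c (near-kept l)

  forbidden-leaf : ∀ c l {e} → exit l ≡ just e → concatMap (fromMaybe ∘ exit) (inner l) ≡ [] →
                   deg G e ≤ 3 → E e (vtx l) → length (forbidden c l) ≤ 3
  forbidden-leaf c l {e} exit≡e no-inner-exits deg≤3 el
    rewrite length-map c (near-kept l) | exit≡e | no-inner-exits | ++-identityʳ (kept-neighbours e) =
    ≤-trans (filter-notAll Kept? (neighbours G e) (lose (∈-neighbours G el) (removed-not-kept l)))
            (subst (_≤ 3) (deg≡length G e) deg≤3)

  module _ (c : Fin n → ℕ) (col : Λ → ℕ) where

    extend : Fin n → ℕ
    extend p with removed-or-kept p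
    ... | inj₁ (l , _) = col l
    ... | inj₂ _ = c p

    extend-∈L : ∀ {L : Fin n → List ℕ} → (∀ p → Kept p → c p ∈ L p) →
                (∀ l → col l ∈ L (vtx l)) → ∀ p → extend p ∈ L p
    extend-∈L c∈L col∈L p with removed-or-kept p
    ... | inj₁ (l , refl) = col∈L l
    ... | inj₂ kp = c∈L p kp

    removed≢kept : (∀ l → col l ∉ forbidden c l) →
                   ∀ l {q} → Kept q → SqAdj E (vtx l) q → col l ≢ c q
    removed≢kept col∉forbidden l kq lq col≡c =
      col∉forbidden l (subst (_∈ forbidden c l) (sym col≡c) (∈-map⁺ c (near-kept-complete l kq lq)))

    extend-proper : (∀ p q → Kept p → Kept q → SqAdj (SubE G G-S) p q → c p ≢ c q) →
                    (∀ l → col l ∉ forbidden c l) →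
                    (∀ l l′ → SqAdj E (vtx l) (vtx l′) → col l ≢ col l′) →
                    ∀ p q → SqAdj E p q → extend p ≢ extend q
    extend-proper c-proper col∉forbidden col-proper p q pq with removed-or-kept p | removed-or-kept q
    ... | inj₁ (l , refl) | inj₁ (l′ , refl) = col-proper l l′ pq
    ... | inj₁ (l , refl) | inj₂ kq = removed≢kept col∉forbidden l kq pq
    ... | inj₂ kp | inj₁ (l , refl) = ≢-sym (removed≢kept col∉forbidden l kp (sqAdj-sym G pq))
    ... | inj₂ kp | inj₂ kq = c-proper p q kp kq (kept-sqAdj kp kq pq)

module HConfigurationReduction (G : Graph) (max-deg : MaxDegAtMost G 3) (girth : GirthAtLeast G 7) where
  open Graph G using (n)

  private
    E : Fin n → Fin n → Set
    E = Edge G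

  record Configuration : Set where
    field
      u v w x v₁ v₂ w₁ w₂ x′ v₁′ v₂′ w₁′ w₂′ : Fin n
      uv : E u v
      uw : E u w
      ux : E u x
      vv₁ : E v v₁
      vv₂ : E v v₂
      ww₁ : E w w₁
      ww₂ : E w w₂
      xx′ : E x x′
      v₁v₁′ : E v₁ v₁′
      v₂v₂′ : E v₂ v₂′
      w₁w₁′ : E w₁ w₁′
      w₂w₂′ : E w₂ w₂′
      deg-u : deg G u ≡ 3
      deg-v : deg G v ≡ 3
      deg-w : deg G w ≡ 3
      deg-x : deg G x ≡ 2
      deg-v₁ : deg G v₁ ≡ 2
      deg-v₂ : deg G v₂ ≡ 2
      deg-w₁ : deg G w₁ ≡ 2
      deg-w₂ : deg G w₂ ≡ 2
      v≢w : v ≢ w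
      v₁≢v₂ : v₁ ≢ v₂
      w₁≢w₂ : w₁ ≢ w₂
      x′≢u : x′ ≢ u
      v₁′≢v : v₁′ ≢ v
      v₂′≢v : v₂′ ≢ v
      w₁′≢w : w₁′ ≢ w
      w₂′≢w : w₂′ ≢ w

  configuration : HConfiguration G → Configuration
  configuration (u , v , w , (deg-u , class-u) , uv , uw , v≢w , (deg-v , class-v) , (deg-w , class-w))
    with class1-neighbour G class-u | class2-neighbours G class-v | class2-neighbours G class-w
  ... | x , ux , deg-x | v₁ , v₂ , v₁≢v₂ , vv₁ , deg-v₁ , vv₂ , deg-v₂
      | w₁ , w₂ , w₁≢w₂ , ww₁ , deg-w₁ , ww₂ , deg-w₂
    with other-neighbour G (≤-reflexive (sym deg-x)) u
       | other-neighbour G (≤-reflexive (sym deg-v₁)) v | other-neighbour G (≤-reflexive (sym deg-v₂)) v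
       | other-neighbour G (≤-reflexive (sym deg-w₁)) w | other-neighbour G (≤-reflexive (sym deg-w₂)) w
  ... | x′ , xx′ , x′≢u | v₁′ , v₁v₁′ , v₁′≢v | v₂′ , v₂v₂′ , v₂′≢v
      | w₁′ , w₁w₁′ , w₁′≢w | w₂′ , w₂w₂′ , w₂′≢w =
    record
      { u = u ; v = v ; w = w ; x = x ; v₁ = v₁ ; v₂ = v₂ ; w₁ = w₁ ; w₂ = w₂
      ; x′ = x′ ; v₁′ = v₁′ ; v₂′ = v₂′ ; w₁′ = w₁′ ; w₂′ = w₂′
      ; uv = uv ; uw = uw ; ux = ux ; vv₁ = vv₁ ; vv₂ = vv₂ ; ww₁ = ww₁ ; ww₂ = ww₂
      ; xx′ = xx′ ; v₁v₁′ = v₁v₁′ ; v₂v₂′ = v₂v₂′ ; w₁w₁′ = w₁w₁′ ; w₂w₂′ = w₂w₂′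
      ; deg-u = deg-u ; deg-v = deg-v ; deg-w = deg-w ; deg-x = deg-x
      ; deg-v₁ = deg-v₁ ; deg-v₂ = deg-v₂ ; deg-w₁ = deg-w₁ ; deg-w₂ = deg-w₂
      ; v≢w = v≢w ; v₁≢v₂ = v₁≢v₂ ; w₁≢w₂ = w₁≢w₂ ; x′≢u = x′≢u
      ; v₁′≢v = v₁′≢v ; v₂′≢v = v₂′≢v ; w₁′≢w = w₁′≢w ; w₂′≢w = w₂′≢w
      }

  swapVW : Configuration → Configuration
  swapVW C = record
    { u = u ; v = w ; w = v ; x = x ; v₁ = w₁ ; v₂ = w₂ ; w₁ = v₁ ; w₂ = v₂
    ; x′ = x′ ; v₁′ = w₁′ ; v₂′ = w₂′ ; w₁′ = v₁′ ; w₂′ = v₂′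
    ; uv = uw ; uw = uv ; ux = ux ; vv₁ = ww₁ ; vv₂ = ww₂ ; ww₁ = vv₁ ; ww₂ = vv₂
    ; xx′ = xx′ ; v₁v₁′ = w₁w₁′ ; v₂v₂′ = w₂w₂′ ; w₁w₁′ = v₁v₁′ ; w₂w₂′ = v₂v₂′
    ; deg-u = deg-u ; deg-v = deg-w ; deg-w = deg-v ; deg-x = deg-x
    ; deg-v₁ = deg-w₁ ; deg-v₂ = deg-w₂ ; deg-w₁ = deg-v₁ ; deg-w₂ = deg-v₂
    ; v≢w = ≢-sym v≢w ; v₁≢v₂ = w₁≢w₂ ; w₁≢w₂ = v₁≢v₂ ; x′≢u = x′≢u
    ; v₁′≢v = w₁′≢w ; v₂′≢v = w₂′≢w ; w₁′≢w = v₁′≢v ; w₂′≢w = v₂′≢v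
    } where open Configuration C

  swapV₁V₂ : Configuration → Configuration
  swapV₁V₂ C = record C
    { v₁ = v₂ ; v₂ = v₁ ; v₁′ = v₂′ ; v₂′ = v₁′ ; vv₁ = vv₂ ; vv₂ = vv₁
    ; v₁v₁′ = v₂v₂′ ; v₂v₂′ = v₁v₁′ ; deg-v₁ = deg-v₂ ; deg-v₂ = deg-v₁
    ; v₁≢v₂ = ≢-sym v₁≢v₂ ; v₁′≢v = v₂′≢v ; v₂′≢v = v₁′≢v
    } where open Configuration C

  swapW₁W₂ : Configuration → Configuration
  swapW₁W₂ = swapVW ∘ swapV₁V₂ ∘ swapVW

  module Basic (C : Configuration) where
    open Configuration C

    u≢v : u ≢ v
    u≢v = edge-≢ G uv

    u≢x : u ≢ x
    u≢x = edge-≢ G ux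

    v≢v₁ : v ≢ v₁
    v≢v₁ = edge-≢ G vv₁

    x≢x′ : x ≢ x′
    x≢x′ = edge-≢ G xx′

    v₁≢v₁′ : v₁ ≢ v₁′
    v₁≢v₁′ = edge-≢ G v₁v₁′

    v≢x : v ≢ x
    v≢x = deg3≢deg2 G deg-v deg-x

    u≢v₁ : u ≢ v₁
    u≢v₁ = deg3≢deg2 G deg-u deg-v₁

    w≢v₁ : w ≢ v₁
    w≢v₁ = deg3≢deg2 G deg-w deg-v₁

  module Neighbourhoods (C : Configuration) where
    open Configuration C
    open Basic C

    u≢w : u ≢ w
    u≢w = Basic.u≢v (swapVW C)

    u≢w₁ : u ≢ w₁
    u≢w₁ = Basic.u≢v₁ (swapVW C)

    w≢w₁ : w ≢ w₁
    w≢w₁ = Basic.v≢v₁ (swapVW C)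

    v≢w₁ : v ≢ w₁
    v≢w₁ = Basic.w≢v₁ (swapVW C)

    nbrs-u : ∀ {m} → E u m → m ∈ v ∷ w ∷ x ∷ []
    nbrs-u = neighbours-complete G (≤-reflexive deg-u)
      ((v≢w ∷ v≢x ∷ []) ∷ (Basic.v≢x (swapVW C) ∷ []) ∷ [] ∷ []) (uv ∷ uw ∷ ux ∷ [])

    nbrs-v : ∀ {m} → E v m → m ∈ u ∷ v₁ ∷ v₂ ∷ []
    nbrs-v = neighbours-complete G (≤-reflexive deg-v)
      ((u≢v₁ ∷ Basic.u≢v₁ (swapV₁V₂ C) ∷ []) ∷ (v₁≢v₂ ∷ []) ∷ [] ∷ [])
      (edge-sym G uv ∷ vv₁ ∷ vv₂ ∷ [])

    nbrs-x : ∀ {m} → E x m → m ∈ u ∷ x′ ∷ []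
    nbrs-x = neighbours-complete G (≤-reflexive deg-x)
      ((≢-sym x′≢u ∷ []) ∷ [] ∷ []) (edge-sym G ux ∷ xx′ ∷ [])

    nbrs-v₁ : ∀ {m} → E v₁ m → m ∈ v ∷ v₁′ ∷ []
    nbrs-v₁ = neighbours-complete G (≤-reflexive deg-v₁)
      ((≢-sym v₁′≢v ∷ []) ∷ [] ∷ []) (edge-sym G vv₁ ∷ v₁v₁′ ∷ [])

  module Distinct (C : Configuration) where
    open Configuration C
    open Basic C
    open Neighbourhoods C

    x≢v₁ : x ≢ v₁
    x≢v₁ = path₃-ends-≢ girth
      ( (≢-sym u≢x ∷ ≢-sym v≢x ∷ [])
      ∷ (u≢v ∷ [])
      ∷ [] ∷ [])
      (edge-sym G ux) uv vv₁

    x′≢v : x′ ≢ v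
    x′≢v = path₃-ends-≢ girth
      ( (≢-sym x≢x′ ∷ x′≢u ∷ [])
      ∷ (≢-sym u≢x ∷ [])
      ∷ [] ∷ [])
      (edge-sym G xx′) (edge-sym G ux) uv

    v₁′≢u : v₁′ ≢ u
    v₁′≢u = path₃-ends-≢ girth
      ( (≢-sym v₁≢v₁′ ∷ v₁′≢v ∷ [])
      ∷ (≢-sym v≢v₁ ∷ [])
      ∷ [] ∷ [])
      (edge-sym G v₁v₁′) (edge-sym G vv₁) (edge-sym G uv)

    x′≢v₁ : x′ ≢ v₁
    x′≢v₁ = path₄-ends-≢ girth
      ( (≢-sym x≢x′ ∷ x′≢u ∷ x′≢v ∷ [])
      ∷ (≢-sym u≢x ∷ ≢-sym v≢x ∷ [])
      ∷ (u≢v ∷ [])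
      ∷ [] ∷ [])
      (edge-sym G xx′) (edge-sym G ux) uv vv₁

    v₁≢w₁ : v₁ ≢ w₁
    v₁≢w₁ = path₄-ends-≢ girth
      ( (≢-sym v≢v₁ ∷ ≢-sym u≢v₁ ∷ ≢-sym w≢v₁ ∷ [])
      ∷ (≢-sym u≢v ∷ v≢w ∷ [])
      ∷ (u≢w ∷ [])
      ∷ [] ∷ [])
      (edge-sym G vv₁) (edge-sym G uv) uw ww₁

    v₁′≢w : v₁′ ≢ w
    v₁′≢w = path₄-ends-≢ girth
      ( (≢-sym v₁≢v₁′ ∷ v₁′≢v ∷ v₁′≢u ∷ [])
      ∷ (≢-sym v≢v₁ ∷ ≢-sym u≢v₁ ∷ [])
      ∷ (≢-sym u≢v ∷ [])
      ∷ [] ∷ [])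
      (edge-sym G v₁v₁′) (edge-sym G vv₁) (edge-sym G uv) uw

    x′≢v₁′ : x′ ≢ v₁′
    x′≢v₁′ = path₅-ends-≢ girth
      ( (≢-sym x≢x′ ∷ x′≢u ∷ x′≢v ∷ x′≢v₁ ∷ [])
      ∷ (≢-sym u≢x ∷ ≢-sym v≢x ∷ x≢v₁ ∷ [])
      ∷ (u≢v ∷ u≢v₁ ∷ [])
      ∷ (v≢v₁ ∷ [])
      ∷ [] ∷ [])
      (edge-sym G xx′) (edge-sym G ux) uv vv₁ v₁v₁′

    v₁≢w₁′ : v₁ ≢ w₁′
    v₁≢w₁′ = path₅-ends-≢ girth
      ( (≢-sym v≢v₁ ∷ ≢-sym u≢v₁ ∷ ≢-sym w≢v₁ ∷ v₁≢w₁ ∷ [])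
      ∷ (≢-sym u≢v ∷ v≢w ∷ v≢w₁ ∷ [])
      ∷ (u≢w ∷ u≢w₁ ∷ [])
      ∷ (w≢w₁ ∷ [])
      ∷ [] ∷ [])
      (edge-sym G vv₁) (edge-sym G uv) uw ww₁ w₁w₁′

  module FarApart (C : Configuration) where
    open Configuration C
    open Basic C
    open Neighbourhoods C
    open Distinct C

    v₁′≢w₁′ : v₁′ ≢ w₁′
    v₁′≢w₁′ = path₆-ends-≢ girth
      ( (≢-sym v₁≢v₁′ ∷ v₁′≢v ∷ v₁′≢u ∷ v₁′≢w ∷ ≢-sym (Distinct.v₁≢w₁′ (swapVW C)) ∷ [])
      ∷ (≢-sym v≢v₁ ∷ ≢-sym u≢v₁ ∷ ≢-sym w≢v₁ ∷ v₁≢w₁ ∷ [])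
      ∷ (≢-sym u≢v ∷ v≢w ∷ v≢w₁ ∷ [])
      ∷ (u≢w ∷ u≢w₁ ∷ [])
      ∷ (w≢w₁ ∷ [])
      ∷ [] ∷ [])
      (edge-sym G v₁v₁′) (edge-sym G vv₁) (edge-sym G uv) uw ww₁ w₁w₁′

    far-x-v₁ : ¬ SqAdj E x v₁
    far-x-v₁ = far-apart G nbrs-x nbrs-v₁
      (≢-sym u≢v₁ ∷ ≢-sym x′≢v₁ ∷ [])
      ( (u≢v ∷ ≢-sym v₁′≢u ∷ [])
      ∷ (x′≢v ∷ x′≢v₁′ ∷ [])
      ∷ [])

    far-v-w₁ : ¬ SqAdj E v w₁
    far-v-w₁ = far-apart G nbrs-v (Neighbourhoods.nbrs-v₁ (swapVW C))
      (≢-sym u≢w₁ ∷ ≢-sym v₁≢w₁ ∷ ≢-sym (Distinct.v₁≢w₁ (swapV₁V₂ C)) ∷ [])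
      ( (u≢w ∷ ≢-sym (Distinct.v₁′≢u (swapVW C)) ∷ [])
      ∷ (≢-sym w≢v₁ ∷ v₁≢w₁′ ∷ [])
      ∷ (≢-sym (Basic.w≢v₁ (swapV₁V₂ C)) ∷ Distinct.v₁≢w₁′ (swapV₁V₂ C) ∷ [])
      ∷ [])

    far-v₁-w₁ : ¬ SqAdj E v₁ w₁
    far-v₁-w₁ = far-apart G nbrs-v₁ (Neighbourhoods.nbrs-v₁ (swapVW C))
      (≢-sym v≢w₁ ∷ Distinct.v₁≢w₁′ (swapVW C) ∷ [])
      ( (v≢w ∷ ≢-sym (Distinct.v₁′≢w (swapVW C)) ∷ [])
      ∷ (v₁′≢w ∷ v₁′≢w₁′ ∷ [])
      ∷ [])

  module Deletion (C : Configuration) where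
    open Configuration C
    open Neighbourhoods C
    open FarApart C

    vtx : Label → Fin n
    vtx U  = u
    vtx V  = v
    vtx W  = w
    vtx X  = x
    vtx V₁ = v₁
    vtx V₂ = v₂
    vtx W₁ = w₁
    vtx W₂ = w₂

    exit : Label → Maybe (Fin n)
    exit X  = just x′
    exit V₁ = just v₁′
    exit V₂ = just v₂′
    exit W₁ = just w₁′
    exit W₂ = just w₂′
    exit _  = nothing

    leaf-cover : ∀ {a b m : Fin n} → m ∈ a ∷ b ∷ [] → just b ≡ just m ⊎ m ∈ a ∷ []
    leaf-cover (here m≡a) = inj₂ (here m≡a)
    leaf-cover (there (here m≡b)) = inj₁ (cong just (sym m≡b))

    cover : ∀ l {m} → E (vtx l) m → exit l ≡ just m ⊎ m ∈ map vtx (tree-neighbours l)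
    cover U  e = inj₂ (nbrs-u e)
    cover V  e = inj₂ (nbrs-v e)
    cover W  e = inj₂ (Neighbourhoods.nbrs-v (swapVW C) e)
    cover X  e = leaf-cover (nbrs-x e)
    cover V₁ e = leaf-cover (nbrs-v₁ e)
    cover V₂ e = leaf-cover (Neighbourhoods.nbrs-v₁ (swapV₁V₂ C) e)
    cover W₁ e = leaf-cover (Neighbourhoods.nbrs-v₁ (swapVW C) e)
    cover W₂ e = leaf-cover (Neighbourhoods.nbrs-v₁ (swapV₁V₂ (swapVW C)) e)

    open Reduction G vtx (image? vtx) exit tree-neighbours cover public

    sqAdj⇒▷-ordered : ∀ l l′ → T (rank l′ <ᵇ rank l) → SqAdj E (vtx l) (vtx l′) → l ▷ l′
    sqAdj⇒▷-ordered V  U  _ _ = v▷u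
    sqAdj⇒▷-ordered X  U  _ _ = x▷u
    sqAdj⇒▷-ordered X  V  _ _ = x▷v
    sqAdj⇒▷-ordered W  U  _ _ = w▷u
    sqAdj⇒▷-ordered W  V  _ _ = w▷v
    sqAdj⇒▷-ordered W  X  _ _ = w▷x
    sqAdj⇒▷-ordered V₂ U  _ _ = v₂▷u
    sqAdj⇒▷-ordered V₂ V  _ _ = v₂▷v
    sqAdj⇒▷-ordered V₂ X  _ h = ⊥-elim (FarApart.far-x-v₁ (swapV₁V₂ C) (sqAdj-sym G h))
    sqAdj⇒▷-ordered V₂ W  _ h = ⊥-elim (FarApart.far-v-w₁ (swapVW (swapV₁V₂ C)) (sqAdj-sym G h))
    sqAdj⇒▷-ordered W₂ U  _ _ = w₂▷u
    sqAdj⇒▷-ordered W₂ V  _ h = ⊥-elim (FarApart.far-v-w₁ (swapW₁W₂ C) (sqAdj-sym G h))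
    sqAdj⇒▷-ordered W₂ X  _ h = ⊥-elim (FarApart.far-x-v₁ (swapV₁V₂ (swapVW C)) (sqAdj-sym G h))
    sqAdj⇒▷-ordered W₂ W  _ _ = w₂▷w
    sqAdj⇒▷-ordered W₂ V₂ _ h =
      ⊥-elim (FarApart.far-v₁-w₁ (swapV₁V₂ (swapW₁W₂ C)) (sqAdj-sym G h))
    sqAdj⇒▷-ordered V₁ U  _ _ = v₁▷u
    sqAdj⇒▷-ordered V₁ V  _ _ = v₁▷v
    sqAdj⇒▷-ordered V₁ X  _ h = ⊥-elim (far-x-v₁ (sqAdj-sym G h))
    sqAdj⇒▷-ordered V₁ W  _ h = ⊥-elim (FarApart.far-v-w₁ (swapVW C) (sqAdj-sym G h))
    sqAdj⇒▷-ordered V₁ V₂ _ _ = v₁▷v₂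
    sqAdj⇒▷-ordered V₁ W₂ _ h = ⊥-elim (FarApart.far-v₁-w₁ (swapW₁W₂ C) h)
    sqAdj⇒▷-ordered W₁ U  _ _ = w₁▷u
    sqAdj⇒▷-ordered W₁ V  _ h = ⊥-elim (far-v-w₁ (sqAdj-sym G h))
    sqAdj⇒▷-ordered W₁ X  _ h = ⊥-elim (FarApart.far-x-v₁ (swapVW C) (sqAdj-sym G h))
    sqAdj⇒▷-ordered W₁ W  _ _ = w₁▷w
    sqAdj⇒▷-ordered W₁ V₂ _ h = ⊥-elim (FarApart.far-v₁-w₁ (swapV₁V₂ C) (sqAdj-sym G h))
    sqAdj⇒▷-ordered W₁ V₁ _ h = ⊥-elim (far-v₁-w₁ (sqAdj-sym G h))
    sqAdj⇒▷-ordered W₁ W₂ _ _ = w₁▷w₂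

    sqAdj⇒▷ : ∀ l l′ → SqAdj E (vtx l) (vtx l′) → l ▷ l′ ⊎ l′ ▷ l
    sqAdj⇒▷ l l′ h with <-cmp (rank l′) (rank l)
    ... | tri< l′<l _ _ = inj₁ (sqAdj⇒▷-ordered l l′ (<⇒<ᵇ l′<l) h)
    ... | tri≈ _ same _ with refl ← rank-injective l′ l same = ⊥-elim (proj₁ h refl)
    ... | tri> _ _ l<l′ = inj₂ (sqAdj⇒▷-ordered l′ l (<⇒<ᵇ l<l′) (sqAdj-sym G h))

    forbidden-small : ∀ c l → length (forbidden c l) ≤ budget l
    forbidden-small c U  = ≤-refl
    forbidden-small c V  = ≤-refl
    forbidden-small c W  = ≤-refl
    forbidden-small c X  = forbidden-leaf c X refl refl (max-deg x′) (edge-sym G xx′)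
    forbidden-small c V₁ = forbidden-leaf c V₁ refl refl (max-deg v₁′) (edge-sym G v₁v₁′)
    forbidden-small c V₂ = forbidden-leaf c V₂ refl refl (max-deg v₂′) (edge-sym G v₂v₂′)
    forbidden-small c W₁ = forbidden-leaf c W₁ refl refl (max-deg w₁′) (edge-sym G w₁w₁′)
    forbidden-small c W₂ = forbidden-leaf c W₂ refl refl (max-deg w₂′) (edge-sym G w₂w₂′)

    reducible : SquareChoosable (SubV G G-S) (SubE G G-S) 6 → SquareChoosable (AllV G) (Edge G) 6
    reducible choosable L L-lists with choosable L L-lists
    ... | c , c∈L , c-proper =
      extend c colouring
      , (λ p _ → extend-∈L c colouring c∈L colouring-∈L p)
      , λ p q _ _ → extend-proper c colouring c-proper colouring-∉K colouring-proper p q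
      where
        open TreeColouring (L ∘ vtx) (proj₂ ∘ L-lists ∘ vtx) (proj₁ ∘ L-lists ∘ vtx)
                           (forbidden c) (forbidden-small c)

        colouring-proper : ∀ l l′ → SqAdj E (vtx l) (vtx l′) → colouring l ≢ colouring l′
        colouring-proper l l′ h with sqAdj⇒▷ l l′ h
        ... | inj₁ l▷l′ = colouring-▷ l▷l′
        ... | inj₂ l′▷l = ≢-sym (colouring-▷ l′▷l)

lemma18 : (G : Graph) → Minimal G 6 → MaxDegAtMost G 3 → GirthAtLeast G 7 →
    ¬ HConfiguration G
lemma18 G (not-choosable , minimal) max-deg girth hconf =
  not-choosable (reducible (minimal G-S (G-S-proper U)))
  where
    open HConfigurationReduction G max-deg girth
    open Deletion (configuration hconf)
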